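{- Let $n,t,\lambda,s$ be positive integers. Then \[m(n,t,\lambda;s+1)\ge\binom{n}{t}-\binom{n-\lceil\lambda/s\rceil+1}{t}.\]
   Context: $[m]=\{1,\dots,m\}$. A sequence $A_1,\dots,A_\lambda$ of subsets of $[n]$ (repetitions allowed) is $k$-disjoint if $\bigcap_{i\in B}A_i=\emptyset$ for every $k$-subset $B\subseteq[\lambda]$ (vacuous if $k>\lambda$). $m(n,t,\lambda;k)$ is the maximum size of a family $\mathcal{F}$ of $t$-subsets of $[n]$ such that no $A_1,\dots,A_\lambda\in\mathcal{F}$ (not necessarily distinct) form a $k$-disjoint sequence. -}

module Defs where

open import Data.Nat using (ℕ; suc; _+_; _∸_; _≡ᵇ_)
open import Data.Nat.DivMod using (_/_)
open import Data.Fin using (Fin)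
open import Data.Fin.Subset using (Subset; _∈_; ∣_∣)
open import Data.List using (List)
import Data.List.Membership.Propositional as LM
open import Relation.Binary.PropositionalEquality using (_≡_)
open import Relation.Nullary using (¬_)

-- ⌈ a / (suc s') ⌉ , i.e. ceiling division by the positive number suc s'
ceilDiv : ℕ → ℕ → ℕ
ceilDiv a s' = (a + s') / suc s'

-- A sequence A_1..A_λ of subsets of [n] (indexed by Fin λ, repetitions allowed)
-- is k-disjoint iff for every k-subset B of [λ], ⋂_{i ∈ B} A_i = ∅.
KDisjoint : ∀ {n l} → ℕ → (Fin l → Subset n) → Set
KDisjoint {n} {l} k A =
  (B : Subset l) → ∣ B ∣ ≡ k → (x : Fin n) → ¬ ((i : Fin l) → i ∈ B → x ∈ A i)

NoKDisjoint : ∀ {n} → ℕ → ℕ → List (Subset n) → Set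
NoKDisjoint {n} l k F =
  (A : Fin l → Subset n) → ((i : Fin l) → A i LM.∈ F) → ¬ KDisjoint k A

-- Take all t-subsets of [n] meeting the first k = ⌈λ/s⌉ − 1 points; there are
-- C(n,t) − C(n−k,t) of them. Each of any λ members contains one of those k points and
-- k·s < λ, so by pigeonhole some point lies in s + 1 of them: no λ members are
-- (s+1)-disjoint.
module Submission where

open import Defs
open import Data.Nat using (ℕ; zero; suc; _+_; _*_; _∸_; _≤_; _<_; s≤s; z<s; _<?_; _≡ᵇ_)
open import Data.Nat.Properties
open import Data.Nat.DivMod using (m/n*n≤m; m≥n⇒m/n>0)
open import Data.Nat.Combinatorics using (_C_; nCk+nC[k+1]≡[n+1]C[k+1])
open import Data.Bool.Properties using (T-≡)
open import Data.Empty using (⊥-elim)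
open import Data.Fin as Fin using (Fin; toℕ)
open import Data.Fin.Properties using (toℕ-injective)
open import Data.Fin.Subset
  using (Subset; inside; outside; ⊥; ⊤; ∁; _∩_; _∈_; _⊆_; ∣_∣; Nonempty)
open import Data.Fin.Subset.Properties
  using (nonempty?; Empty-unique; ∉⊥; ∣⊥∣≡0; ∣⊤∣≡n; p⊆q⇒∣p∣≤∣q∣; x∈∁p⇒x∉p;
         p∩q⊆p; p∩q⊆q; x∈p∩q⁺; x∈p∩q⁻)
open import Data.Vec using ([]; _∷_; tabulate; here; there)
open import Data.Vec.Properties using (∷-injectiveʳ; []=⇒lookup; lookup⇒[]=; lookup∘tabulate)
open import Data.List using (List; []; _∷_; _++_; map; length)
open import Data.List.Properties using (length-++; length-map)
open import Data.List.Membership.Propositional using () renaming (_∈_ to _∈ₗ_)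
open import Data.List.Membership.Propositional.Properties using (∈-map⁻; ∈-++⁻)
open import Data.List.Relation.Unary.All as All using (All; []; _∷_)
import Data.List.Relation.Unary.All.Properties as All
open import Data.List.Relation.Unary.AllPairs using ([]; _∷_)
open import Data.List.Relation.Unary.Unique.Propositional using (Unique)
import Data.List.Relation.Unary.Unique.Propositional.Properties as Unique
open import Data.Product using (Σ; _×_; _,_; proj₁; proj₂; ∃-syntax; map₂)
open import Data.Sum using (inj₁; inj₂)
open import Function using (_∘_; Equivalence)
open import Relation.Binary.PropositionalEquality
  using (_≡_; refl; sym; trans; cong; cong₂; subst; module ≡-Reasoning)
open import Relation.Nullary using (¬_; yes; no; contradiction)

∣p∣>0⇒nonempty : ∀ {n} {p : Subset n} → 0 < ∣ p ∣ → Nonempty p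
∣p∣>0⇒nonempty {n} {p} 0<∣p∣ with nonempty? p
... | yes p≢∅ = p≢∅
... | no  p≡∅ = contradiction (trans (cong ∣_∣ (Empty-unique p≡∅)) (∣⊥∣≡0 n)) (>⇒≢ 0<∣p∣)

∣p∩q∣+∣p∩∁q∣≡∣p∣ : ∀ {n} (p q : Subset n) → ∣ p ∩ q ∣ + ∣ p ∩ ∁ q ∣ ≡ ∣ p ∣
∣p∩q∣+∣p∩∁q∣≡∣p∣ []            []            = refl
∣p∩q∣+∣p∩∁q∣≡∣p∣ (inside  ∷ p) (inside  ∷ q) = cong suc (∣p∩q∣+∣p∩∁q∣≡∣p∣ p q)
∣p∩q∣+∣p∩∁q∣≡∣p∣ (inside  ∷ p) (outside ∷ q) =
  trans (+-suc ∣ p ∩ q ∣ _) (cong suc (∣p∩q∣+∣p∩∁q∣≡∣p∣ p q))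
∣p∩q∣+∣p∩∁q∣≡∣p∣ (outside ∷ p) (_       ∷ q) = ∣p∩q∣+∣p∩∁q∣≡∣p∣ p q

subset-of-size : ∀ {n} (p : Subset n) {k} → k ≤ ∣ p ∣ → ∃[ q ] q ⊆ p × ∣ q ∣ ≡ k
subset-of-size {n} p {zero} _ = ⊥ , (λ x∈⊥ → contradiction x∈⊥ ∉⊥) , ∣⊥∣≡0 n
subset-of-size (inside  ∷ p) {suc k} (s≤s k≤∣p∣) with subset-of-size p k≤∣p∣
... | q , q⊆p , ∣q∣≡k =
  inside ∷ q , (λ { here → here ; (there x∈q) → there (q⊆p x∈q) }) , cong suc ∣q∣≡k
subset-of-size (outside ∷ p) {suc k} 1+k≤∣p∣ with subset-of-size p 1+k≤∣p∣
... | q , q⊆p , ∣q∣≡k = outside ∷ q , (λ { (there x∈q) → there (q⊆p x∈q) }) , ∣q∣≡k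

fiber : ∀ {l} → (Fin l → ℕ) → ℕ → Subset l
fiber g x = tabulate (λ i → g i ≡ᵇ x)

∈-fiber⁺ : ∀ {l} {g : Fin l → ℕ} {x i} → g i ≡ x → i ∈ fiber g x
∈-fiber⁺ {g = g} {x} {i} gi≡x =
  lookup⇒[]= i _ (trans (lookup∘tabulate _ i) (Equivalence.to T-≡ (≡⇒≡ᵇ (g i) x gi≡x)))

∈-fiber⁻ : ∀ {l} {g : Fin l → ℕ} {x i} → i ∈ fiber g x → g i ≡ x
∈-fiber⁻ {g = g} {x} {i} i∈fiber =
  ≡ᵇ⇒≡ (g i) x (Equivalence.from T-≡ (trans (sym (lookup∘tabulate _ i)) ([]=⇒lookup i∈fiber)))

-- Induction on the bound m: either the fiber over m is already crowded, or removing it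
-- from the domain D loses at most s points.
pigeonhole : ∀ {l} (g : Fin l → ℕ) m s (D : Subset l) →
  (∀ {i} → i ∈ D → g i < m) → m * s < ∣ D ∣ → ∃[ x ] s < ∣ D ∩ fiber g x ∣
pigeonhole g zero s D g<0 0<∣D∣ = ⊥-elim (n≮0 (g<0 (proj₂ (∣p∣>0⇒nonempty 0<∣D∣))))
pigeonhole g (suc m) s D g<1+m [1+m]s<∣D∣ with s <? ∣ D ∩ fiber g m ∣
... | yes crowded = m , crowded
... | no  sparse  = map₂ (λ {x} s<∣D′∩q∣ → <-≤-trans s<∣D′∩q∣ (p⊆q⇒∣p∣≤∣q∣ (D′∩q⊆D∩q {fiber g x})))
                         (pigeonhole g m s D′ g<m ms<∣D′∣)
  where
  D′ = D ∩ ∁ (fiber g m)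

  g<m : ∀ {i} → i ∈ D′ → g i < m
  g<m i∈D′ with x∈p∩q⁻ D _ i∈D′
  ... | i∈D , i∈∁F = ≤∧≢⇒< (m<1+n⇒m≤n (g<1+m i∈D)) (λ gi≡m → x∈∁p⇒x∉p i∈∁F (∈-fiber⁺ {g = g} gi≡m))

  ms<∣D′∣ : m * s < ∣ D′ ∣
  ms<∣D′∣ = +-cancelˡ-< s _ _ (begin-strict
    s + m * s                     <⟨ [1+m]s<∣D∣ ⟩
    ∣ D ∣                         ≡⟨ ∣p∩q∣+∣p∩∁q∣≡∣p∣ D (fiber g m) ⟨
    ∣ D ∩ fiber g m ∣ + ∣ D′ ∣    ≤⟨ +-monoˡ-≤ ∣ D′ ∣ (≮⇒≥ sparse) ⟩
    s + ∣ D′ ∣                    ∎)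
    where open ≤-Reasoning

  D′∩q⊆D∩q : ∀ {q} → D′ ∩ q ⊆ D ∩ q
  D′∩q⊆D∩q i∈D′∩q with x∈p∩q⁻ D′ _ i∈D′∩q
  ... | i∈D′ , i∈q = x∈p∩q⁺ (p∩q⊆p D _ i∈D′ , i∈q)

large-fiber : ∀ {l n} (f : Fin l → Fin n) k s → (∀ i → toℕ (f i) < k) → k * s < l →
  ∃[ B ] ∣ B ∣ ≡ suc s × ∃[ y ] (∀ {i} → i ∈ B → f i ≡ y)
large-fiber {l} f k s f<k ks<l
  with pigeonhole (toℕ ∘ f) k s ⊤ (λ {i} _ → f<k i) (subst (k * s <_) (sym (∣⊤∣≡n l)) ks<l)
... | x , crowded with subset-of-size (⊤ ∩ fiber (toℕ ∘ f) x) crowded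
... | B , B⊆fiber , ∣B∣≡1+s with ∣p∣>0⇒nonempty (subst (0 <_) (sym ∣B∣≡1+s) z<s)
... | i₀ , i₀∈B =
  B , ∣B∣≡1+s , f i₀ , λ i∈B → toℕ-injective (trans (over-x i∈B) (sym (over-x i₀∈B)))
  where
  over-x : ∀ {i} → i ∈ B → toℕ (f i) ≡ x
  over-x i∈B = ∈-fiber⁻ {g = toℕ ∘ f} (p∩q⊆q ⊤ _ (B⊆fiber i∈B))

meetsFirst⇒noKDisjoint : ∀ {n} {F : List (Subset n)} k s l →
  (∀ {A} → A ∈ₗ F → ∃[ j ] toℕ j < k × j ∈ A) → k * s < l → NoKDisjoint l (suc s) F
meetsFirst⇒noKDisjoint k s l meets ks<l A A∈F kDisjoint
  with large-fiber (λ i → proj₁ (meets (A∈F i))) k s (λ i → proj₁ (proj₂ (meets (A∈F i)))) ks<l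
... | B , ∣B∣≡1+s , y , B↦y =
  kDisjoint B ∣B∣≡1+s y (λ i i∈B → subst (_∈ A i) (B↦y i∈B) (proj₂ (proj₂ (meets (A∈F i)))))

branch : ∀ {n} → List (Subset n) → List (Subset n) → List (Subset (suc n))
branch xs ys = map (inside ∷_) xs ++ map (outside ∷_) ys

module _ {n} {xs ys : List (Subset n)} where

  branch-unique : Unique xs → Unique ys → Unique (branch xs ys)
  branch-unique xs-unique ys-unique =
    Unique.++⁺ (Unique.map⁺ ∷-injectiveʳ xs-unique) (Unique.map⁺ ∷-injectiveʳ ys-unique) sides-differ
    where
    sides-differ : ∀ {A} → ¬ (A ∈ₗ map (inside ∷_) xs × A ∈ₗ map (outside ∷_) ys)
    sides-differ (A∈ins , A∈outs) with ∈-map⁻ (inside ∷_) A∈ins | ∈-map⁻ (outside ∷_) A∈outs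
    ... | _ , _ , refl | _ , _ , ()

  branch-size : ∀ {t} → All (λ A → ∣ A ∣ ≡ t) xs → All (λ A → ∣ A ∣ ≡ suc t) ys →
    All (λ A → ∣ A ∣ ≡ suc t) (branch xs ys)
  branch-size ∣xs∣≡t ∣ys∣≡1+t = All.++⁺ (All.map⁺ (All.map (cong suc) ∣xs∣≡t)) (All.map⁺ ∣ys∣≡1+t)

length-branch : ∀ {n} (xs ys : List (Subset n)) → length (branch xs ys) ≡ length xs + length ys
length-branch xs ys = trans (length-++ (map (inside ∷_) xs))
  (cong₂ _+_ (length-map (inside ∷_) xs) (length-map (outside ∷_) ys))

combinations : (n t : ℕ) → List (Subset n)
combinations n       zero    = ⊥ ∷ []
combinations zero    (suc t) = []
combinations (suc n) (suc t) = branch (combinations n t) (combinations n (suc t))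

combinations-unique : ∀ n t → Unique (combinations n t)
combinations-unique n       zero    = [] ∷ []
combinations-unique zero    (suc t) = []
combinations-unique (suc n) (suc t) =
  branch-unique (combinations-unique n t) (combinations-unique n (suc t))

combinations-size : ∀ n t → All (λ A → ∣ A ∣ ≡ t) (combinations n t)
combinations-size n       zero    = ∣⊥∣≡0 n ∷ []
combinations-size zero    (suc t) = []
combinations-size (suc n) (suc t) =
  branch-size (combinations-size n t) (combinations-size n (suc t))

length-combinations : ∀ n t → length (combinations n t) ≡ n C t
length-combinations n       zero    = refl
length-combinations zero    (suc t) = refl
length-combinations (suc n) (suc t) = begin
  length (branch (combinations n t) (combinations n (suc t)))
    ≡⟨ length-branch (combinations n t) (combinations n (suc t)) ⟩
  length (combinations n t) + length (combinations n (suc t))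
    ≡⟨ cong₂ _+_ (length-combinations n t) (length-combinations n (suc t)) ⟩
  n C t + n C suc t
    ≡⟨ nCk+nC[k+1]≡[n+1]C[k+1] n t ⟩
  suc n C suc t ∎
  where open ≡-Reasoning

meetingFirst : (k n t : ℕ) → List (Subset n)
meetingFirst zero    n       t       = []
meetingFirst (suc k) zero    t       = []
meetingFirst (suc k) (suc n) zero    = []
meetingFirst (suc k) (suc n) (suc t) = branch (combinations n t) (meetingFirst k n (suc t))

meetingFirst-unique : ∀ k n t → Unique (meetingFirst k n t)
meetingFirst-unique zero    n       t       = []
meetingFirst-unique (suc k) zero    t       = []
meetingFirst-unique (suc k) (suc n) zero    = []
meetingFirst-unique (suc k) (suc n) (suc t) =
  branch-unique (combinations-unique n t) (meetingFirst-unique k n (suc t))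

meetingFirst-size : ∀ k n t → All (λ A → ∣ A ∣ ≡ t) (meetingFirst k n t)
meetingFirst-size zero    n       t       = []
meetingFirst-size (suc k) zero    t       = []
meetingFirst-size (suc k) (suc n) zero    = []
meetingFirst-size (suc k) (suc n) (suc t) =
  branch-size (combinations-size n t) (meetingFirst-size k n (suc t))

length-meetingFirst : ∀ k n t → length (meetingFirst k n t) + (n ∸ k) C t ≡ n C t
length-meetingFirst zero    n       t       = refl
length-meetingFirst (suc k) zero    t       = refl
length-meetingFirst (suc k) (suc n) zero    = refl
length-meetingFirst (suc k) (suc n) (suc t) = begin
  length (branch (combinations n t) M) + (n ∸ k) C suc t
    ≡⟨ cong (_+ (n ∸ k) C suc t) (length-branch (combinations n t) M) ⟩
  length (combinations n t) + length M + (n ∸ k) C suc t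
    ≡⟨ +-assoc (length (combinations n t)) (length M) _ ⟩
  length (combinations n t) + (length M + (n ∸ k) C suc t)
    ≡⟨ cong₂ _+_ (length-combinations n t) (length-meetingFirst k n (suc t)) ⟩
  n C t + n C suc t
    ≡⟨ nCk+nC[k+1]≡[n+1]C[k+1] n t ⟩
  suc n C suc t ∎
  where
  M = meetingFirst k n (suc t)
  open ≡-Reasoning

∈-meetingFirst⁻ : ∀ k n t {A} → A ∈ₗ meetingFirst k n t → ∃[ j ] toℕ j < k × j ∈ A
∈-meetingFirst⁻ (suc k) (suc n) (suc t) A∈
  with ∈-++⁻ (map (inside ∷_) (combinations n t)) A∈
... | inj₁ A∈ins with ∈-map⁻ (inside ∷_) A∈ins
...   | _ , _ , refl = Fin.zero , z<s , here
∈-meetingFirst⁻ (suc k) (suc n) (suc t) A∈ | inj₂ A∈outs with ∈-map⁻ (outside ∷_) A∈outs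
...   | B , B∈ , refl with ∈-meetingFirst⁻ k n (suc t) B∈
...     | j , j<k , j∈B = Fin.suc j , s≤s j<k , there j∈B

ceilDiv>0 : ∀ m s → 0 < m → 0 < ceilDiv m s
ceilDiv>0 (suc m) s _ = m≥n⇒m/n>0 (s≤s (m≤n+m s m))

[ceilDiv∸1]*[1+s]<m : ∀ m s → 0 < m → (ceilDiv m s ∸ 1) * suc s < m
[ceilDiv∸1]*[1+s]<m (suc m) s _ = begin-strict
  (c ∸ 1) * suc s           ≡⟨ *-distribʳ-∸ (suc s) c 1 ⟩
  c * suc s ∸ 1 * suc s     ≤⟨ ∸-monoˡ-≤ (1 * suc s) (m/n*n≤m (suc m + s) (suc s)) ⟩
  suc m + s ∸ 1 * suc s     ≡⟨ cong (suc m + s ∸_) (*-identityˡ (suc s)) ⟩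
  m + s ∸ s                 ≡⟨ m+n∸n≡m m s ⟩
  m                         <⟨ n<1+n m ⟩
  suc m                     ∎
  where
  c = ceilDiv (suc m) s
  open ≤-Reasoning

n+1∸m≡n∸[m∸1] : ∀ n m → 0 < m → n + 1 ∸ m ≡ n ∸ (m ∸ 1)
n+1∸m≡n∸[m∸1] n (suc m) _ = cong (_∸ suc m) (+-comm n 1)

lemma5p4 : (n' t' l' s' : ℕ) →
    Σ (List (Subset (suc n'))) λ F →
    Unique F × All (λ A → ∣ A ∣ ≡ suc t') F × NoKDisjoint (suc l') (suc (suc s')) F
    × ((suc n') C (suc t')) ∸ (((suc n' + 1) ∸ ceilDiv (suc l') s') C (suc t')) ≤ length F
lemma5p4 n' t' l' s' =
  meetingFirst k n t , meetingFirst-unique k n t , meetingFirst-size k n t ,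
  meetsFirst⇒noKDisjoint k (suc s') (suc l') (∈-meetingFirst⁻ k n t)
    ([ceilDiv∸1]*[1+s]<m (suc l') s' z<s) ,
  ≤-reflexive size
  where
  n = suc n'
  t = suc t'
  c = ceilDiv (suc l') s'
  k = c ∸ 1
  L = length (meetingFirst k n t)

  size : n C t ∸ ((n + 1) ∸ c) C t ≡ L
  size = begin
    n C t ∸ ((n + 1) ∸ c) C t  ≡⟨ cong (λ r → n C t ∸ r C t) (n+1∸m≡n∸[m∸1] n c (ceilDiv>0 (suc l') s' z<s)) ⟩
    n C t ∸ (n ∸ k) C t        ≡⟨ cong (_∸ (n ∸ k) C t) (length-meetingFirst k n t) ⟨
    L + (n ∸ k) C t ∸ (n ∸ k) C t ≡⟨ m+n∸n≡m L ((n ∸ k) C t) ⟩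
    L                          ∎
    where open ≡-Reasoning
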